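{- Let $G$ and $H$ be finite, simple, connected graphs, each with at least two vertices. Let $S_1=\{g_1,g_2\}\subseteq V(G)$ and $S_2=\{h_1,h_2,h_3\}\subseteq V(H)$ be such that $S_1\times S_2$ has cardinality $6$. Then: (i) $(g_2,h_2)\notin I[\{(g_1,h_1),(g_1,h_2),(g_2,h_1)\}]$; (ii) if $h_3\notin I[h_1,h_2]$, then $(g_2,h_3)\notin I[(g_1,h_1),(g_1,h_2)]$; (iii) if $h_3\notin I[h_1,h_2]$, then $(g_1,h_3)\notin I[(g_1,h_1),(g_2,h_2)]$.
   Context: In a connected graph, the closed interval $I[x,y]$ consists of $x$, $y$ and all vertices on some shortest $x$–$y$ path, and for a vertex set $S$, $I[S]=\bigcup_{u,v\in S}I[u,v]$ (intervals of pairs of vertices of $G\boxtimes H$ are taken in $G\boxtimes H$, and $I[h_1,h_2]$ in $H$). The strong product $G\boxtimes H$ has vertex set $V(G)\times V(H)$, with $(g,h)$ and $(g',h')$ adjacent whenever ($g=g'$ and $hh'\in E(H)$), or ($h=h'$ and $gg'\in E(G)$), or ($gg'\in E(G)$ and $hh'\in E(H)$). -}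

module Defs where

open import Data.Nat using (ℕ; zero; suc; _≤_)
open import Data.Fin using (Fin)
open import Data.Bool using (Bool; true; false)
open import Data.Product using (Σ; ∃; _×_; _,_)
open import Data.Sum using (_⊎_)
open import Data.List using (List; []; _∷_)
open import Data.List.Membership.Propositional using (_∈_)
open import Relation.Binary.PropositionalEquality using (_≡_)
open import Relation.Nullary using (¬_)

record Graph : Set₁ where
  field
    n      : ℕ
    adj    : Fin n → Fin n → Bool
    sym    : ∀ x y → adj x y ≡ adj y x
    irrefl : ∀ x → adj x x ≡ false

  V : Set
  V = Fin n

  Adj : V → V → Set
  Adj x y = adj x y ≡ true

open Graph public

data Walk {V : Set} (E : V → V → Set) : V → V → ℕ → Set where
  here : ∀ x → Walk E x x zero
  step : ∀ {x y z k} → E x y → Walk E y z k → Walk E x z (suc k)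

verts : ∀ {V : Set} {E : V → V → Set} {x y k} → Walk E x y k → List V
verts (here x) = x ∷ []
verts (step {x = x} _ w) = x ∷ verts w

IsShortest : ∀ {V : Set} {E : V → V → Set} {x y k} → Walk E x y k → Set
IsShortest {E = E} {x} {y} {k} _ = ∀ k' → Walk E x y k' → k ≤ k'

-- z ∈ I[x,y]: z lies on some shortest x–y walk (= shortest path)
InInterval : ∀ {V : Set} (E : V → V → Set) → V → V → V → Set
InInterval E x y z = Σ ℕ λ k → Σ (Walk E x y k) λ w → IsShortest w × (z ∈ verts w)

InIntervalSet : ∀ {V : Set} (E : V → V → Set) → List V → V → Set
InIntervalSet E S z = Σ _ λ u → Σ _ λ v → u ∈ S × v ∈ S × InInterval E u v z

Connected : Graph → Set
Connected G = ∀ (x y : V G) → ∃ λ k → Walk (Adj G) x y k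

StrongAdj : (G H : Graph) → V G × V H → V G × V H → Set
StrongAdj G H (g , h) (g' , h') =
  (g ≡ g' × Adj H h h') ⊎ (h ≡ h' × Adj G g g') ⊎ (Adj G g g' × Adj H h h')

module Submission where

-- Work with walks instead of distances: z ∈ I[x,y] is witnessed
-- by walks x → z and z → y of lengths i and j such that i + j bounds the length
-- of every x–y walk (a "betweenness witness").  Two facts about the strong
-- product G ⊠ H drive everything:
--   * projection: a walk of length k in G ⊠ H projects to walks of length ≤ k
--     in G and in H;
--   * combination: walks of lengths a in G and b in H combine to a walk of
--     length ≤ max(a,b) in G ⊠ H (lifting a walk of one factor is the special
--     case where the other walk is trivial).
-- For (i), every pair from S admits an x–y walk of length ≤ i or ≤ j built by
-- projecting and recombining the two halves of the witness; since (g₂,h₂) is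
-- neither endpoint, both halves are non-trivial and this beats i + j.
-- For (ii) and (iii), the H-projections of the two halves form an h₁–h₃–h₂
-- walk whose length is bounded by every h₁–h₂ walk in H, so h₃ ∈ I[h₁,h₂].

open import Defs
open import Data.Nat using (ℕ; suc; _+_; _⊔_; _≤_; _<_; z≤n; s≤s)
open import Data.Nat.Properties
  using (≤-refl; ≤-trans; n≤1+n; ≤-total; +-mono-≤; ⊔-mono-≤; m≤m⊔n; m≤n⇒m⊔n≡n; m≥n⇒m⊔n≡m;
         m<m+n; m<n+m; <⇒≱)
open import Data.Product using (Σ; _×_; _,_; proj₁; proj₂)
open import Data.Sum using (_⊎_; inj₁; inj₂; [_,_]; swap)
open import Data.List using (_∷_; [])
open import Data.List.Membership.Propositional using (_∈_)
open import Data.List.Relation.Unary.Any using (here; there)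
open import Relation.Binary.PropositionalEquality
  using (_≡_; _≢_; refl; cong; subst; ≢-sym)
open import Relation.Nullary using (¬_)
open import Data.Empty using (⊥-elim)
open import Function using (_∘_)

module Walks {A : Set} (E : A → A → Set) where

  Reach : A → A → ℕ → Set
  Reach x y k = Σ ℕ λ l → l ≤ k × Walk E x y l

  reach-weaken : ∀ {x y k k'} → k ≤ k' → Reach x y k → Reach x y k'
  reach-weaken k≤k' (l , l≤k , w) = l , ≤-trans l≤k k≤k' , w

  reach-⊔ : ∀ {x y} m n → Reach x y (m ⊔ n) → Reach x y m ⊎ Reach x y n
  reach-⊔ m n r with ≤-total m n
  ... | inj₁ m≤n = inj₂ (subst (Reach _ _) (m≤n⇒m⊔n≡n m≤n) r)
  ... | inj₂ n≤m = inj₁ (subst (Reach _ _) (m≥n⇒m⊔n≡m n≤m) r)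

  walk-positive : ∀ {x y k} → x ≢ y → Walk E x y k → 0 < k
  walk-positive x≢x (here _) = ⊥-elim (x≢x refl)
  walk-positive _ (step _ _) = s≤s z≤n

  concat : ∀ {x y z i j} → Walk E x y i → Walk E y z j → Walk E x z (i + j)
  concat (here _) q = q
  concat (step e p) q = step e (concat p q)

  concat-visits-middle : ∀ {x y z i j} (p : Walk E x y i) (q : Walk E y z j) →
    y ∈ verts (concat p q)
  concat-visits-middle (here _) (here _) = here refl
  concat-visits-middle (here _) (step _ _) = here refl
  concat-visits-middle (step _ p) q = there (concat-visits-middle p q)

  split-at : ∀ {x y z k} (w : Walk E x y k) → z ∈ verts w →
    Σ ℕ λ i → Σ ℕ λ j → Walk E x z i × Walk E z y j × (i + j ≡ k)
  split-at (here x) (here refl) = 0 , 0 , here x , here x , refl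
  split-at (step {x = x} e w) (here refl) = 0 , _ , here x , step e w , refl
  split-at (step e w) (there z∈w) with split-at w z∈w
  ... | i , j , p , q , i+j≡k = suc i , j , step e p , q , cong suc i+j≡k

  record Between (x y z : A) : Set where
    field
      i j     : ℕ
      toZ     : Walk E x z i
      fromZ   : Walk E z y j
      minimal : ∀ k → Walk E x y k → i + j ≤ k

    minimal-reach : ∀ {k} → Reach x y k → i + j ≤ k
    minimal-reach (l , l≤k , w) = ≤-trans (minimal l w) l≤k

    not-past-end : z ≢ y → ¬ Reach x y i
    not-past-end z≢y r = <⇒≱ (m<m+n i (walk-positive z≢y fromZ)) (minimal-reach r)

    not-before-start : z ≢ x → ¬ Reach x y j
    not-before-start z≢x r =
      <⇒≱ (m<n+m j (walk-positive (≢-sym z≢x) toZ)) (minimal-reach r)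

    inner : z ≢ x → z ≢ y → ¬ (Reach x y i ⊎ Reach x y j)
    inner z≢x z≢y = [ not-past-end z≢y , not-before-start z≢x ]

    minimal-⊔ : z ≢ x → ∀ {k} → Reach x y (j ⊔ k) → i + j ≤ k
    minimal-⊔ z≢x r =
      [ (λ r-j → ⊥-elim (not-before-start z≢x r-j)) , minimal-reach ] (reach-⊔ j _ r)

  open Between public

  interval⇒between : ∀ {x y z} → InInterval E x y z → Between x y z
  interval⇒between (k , w , shortest , z∈w) with split-at w z∈w
  ... | i , j , p , q , refl = record
    { i = i ; j = j ; toZ = p ; fromZ = q ; minimal = shortest }

  between⇒interval : ∀ {x y z} → Between x y z → InInterval E x y z
  between⇒interval b =
    i b + j b , concat (toZ b) (fromZ b) , minimal b ,
    concat-visits-middle (toZ b) (fromZ b)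

module StrongProduct (G H : Graph) where

  open Walks

  _⊠_ : V G × V H → V G × V H → Set
  _⊠_ = StrongAdj G H

  project-G : ∀ {g h g' h' k} → Walk _⊠_ (g , h) (g' , h') k → Reach (Adj G) g g' k
  project-G (here _) = 0 , z≤n , here _
  project-G (step {y = _ , _} move w) with project-G w | move
  ... | l , l≤k , w' | inj₁ (refl , _)        = l , ≤-trans l≤k (n≤1+n _) , w'
  ... | l , l≤k , w' | inj₂ (inj₁ (_ , e))    = suc l , s≤s l≤k , step e w'
  ... | l , l≤k , w' | inj₂ (inj₂ (e , _))    = suc l , s≤s l≤k , step e w'

  project-H : ∀ {g h g' h' k} → Walk _⊠_ (g , h) (g' , h') k → Reach (Adj H) h h' k
  project-H (here _) = 0 , z≤n , here _
  project-H (step {y = _ , _} move w) with project-H w | move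
  ... | l , l≤k , w' | inj₁ (_ , e)           = suc l , s≤s l≤k , step e w'
  ... | l , l≤k , w' | inj₂ (inj₁ (refl , _)) = l , ≤-trans l≤k (n≤1+n _) , w'
  ... | l , l≤k , w' | inj₂ (inj₂ (_ , e))    = suc l , s≤s l≤k , step e w'

  along-G : ∀ {g g' h k} → Walk (Adj G) g g' k → Walk _⊠_ (g , h) (g' , h) k
  along-G (here _) = here _
  along-G (step e w) = step (inj₂ (inj₁ (refl , e))) (along-G w)

  along-H : ∀ {g h h' k} → Walk (Adj H) h h' k → Walk _⊠_ (g , h) (g , h') k
  along-H (here _) = here _
  along-H (step e w) = step (inj₁ (refl , e)) (along-H w)

  lift-G : ∀ {g g' h k} → Reach (Adj G) g g' k → Reach _⊠_ (g , h) (g' , h) k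
  lift-G (l , l≤k , w) = l , l≤k , along-G w

  lift-H : ∀ {g h h' k} → Reach (Adj H) h h' k → Reach _⊠_ (g , h) (g , h') k
  lift-H (l , l≤k , w) = l , l≤k , along-H w

  -- Walks of lengths a in G and b in H combine to a product walk of length
  -- at most max(a,b): move diagonally while both walks last.
  combine-walks : ∀ {g g' h h' a b} → Walk (Adj G) g g' a → Walk (Adj H) h h' b →
    Reach _⊠_ (g , h) (g' , h') (a ⊔ b)
  combine-walks (here _) wH = _ , ≤-refl , along-H wH
  combine-walks {a = a} wG (here _) = a , m≤m⊔n a 0 , along-G wG
  combine-walks (step eG wG) (step eH wH) with combine-walks wG wH
  ... | l , l≤k , w = suc l , s≤s l≤k , step (inj₂ (inj₂ (eG , eH))) w

  combine : ∀ {g g' h h' a b} → Reach (Adj G) g g' a → Reach (Adj H) h h' b →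
    Reach _⊠_ (g , h) (g' , h') (a ⊔ b)
  combine (_ , la , wG) (_ , lb , wH) = reach-weaken _⊠_ (⊔-mono-≤ la lb) (combine-walks wG wH)

  between-projects-H : ∀ {g g' g'' h h' h''} (b : Between _⊠_ (g , h) (g' , h') (g'' , h'')) →
    (∀ k → Walk (Adj H) h h' k → i b + j b ≤ k) →
    InInterval (Adj H) h h' h''
  between-projects-H b bound with project-H (toZ b) | project-H (fromZ b)
  ... | a , a≤i , wa | c , c≤j , wc = between⇒interval (Adj H) record
    { i = a ; j = c ; toZ = wa ; fromZ = wc
    ; minimal = λ k w → ≤-trans (+-mono-≤ a≤i c≤j) (bound k w) }

open Walks

lemma4 : (G H : Graph) → Connected G → Connected H → 2 ≤ n G → 2 ≤ n H →
    (g₁ g₂ : V G) (h₁ h₂ h₃ : V H) →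
    g₁ ≢ g₂ → h₁ ≢ h₂ → h₁ ≢ h₃ → h₂ ≢ h₃ →
    (¬ InIntervalSet (StrongAdj G H) ((g₁ , h₁) ∷ (g₁ , h₂) ∷ (g₂ , h₁) ∷ []) (g₂ , h₂))
    × (¬ InInterval (Adj H) h₁ h₂ h₃ → ¬ InInterval (StrongAdj G H) (g₁ , h₁) (g₁ , h₂) (g₂ , h₃))
    × (¬ InInterval (Adj H) h₁ h₂ h₃ → ¬ InInterval (StrongAdj G H) (g₁ , h₁) (g₂ , h₂) (g₁ , h₃))
lemma4 G H _ _ _ _ g₁ g₂ h₁ h₂ h₃ g₁≢g₂ h₁≢h₂ h₁≢h₃ _ = part-i , part-ii , part-iii
  where
  open StrongProduct G H
  S = (g₁ , h₁) ∷ (g₁ , h₂) ∷ (g₂ , h₁) ∷ []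

  outside : ∀ {u} → u ∈ S → (g₂ , h₂) ≢ u
  outside (here refl)                 = ≢-sym (g₁≢g₂ ∘ cong proj₁)
  outside (there (here refl))         = ≢-sym (g₁≢g₂ ∘ cong proj₁)
  outside (there (there (here refl))) = ≢-sym (h₁≢h₂ ∘ cong proj₂)

  shortcut : ∀ {u v} → u ∈ S → v ∈ S → (b : Between _⊠_ u v (g₂ , h₂)) →
    Reach _⊠_ u v (i b) ⊎ Reach _⊠_ u v (j b)
  shortcut (here refl) (here refl) _ = inj₁ (0 , z≤n , here _)
  shortcut (there (here refl)) (there (here refl)) _ = inj₁ (0 , z≤n , here _)
  shortcut (there (there (here refl))) (there (there (here refl))) _ = inj₁ (0 , z≤n , here _)
  shortcut (here refl) (there (here refl)) b = inj₁ (lift-H (project-H (toZ b)))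
  shortcut (there (here refl)) (here refl) b = inj₂ (lift-H (project-H (fromZ b)))
  shortcut (here refl) (there (there (here refl))) b = inj₁ (lift-G (project-G (toZ b)))
  shortcut (there (there (here refl))) (here refl) b = inj₂ (lift-G (project-G (fromZ b)))
  shortcut (there (here refl)) (there (there (here refl))) b =
    reach-⊔ _⊠_ _ _ (combine (project-G (toZ b)) (project-H (fromZ b)))
  shortcut (there (there (here refl))) (there (here refl)) b =
    swap (reach-⊔ _⊠_ _ _ (combine (project-G (fromZ b)) (project-H (toZ b))))

  part-i : ¬ InIntervalSet _⊠_ S (g₂ , h₂)
  part-i (_ , _ , u∈S , v∈S , z∈I) =
    inner b (outside u∈S) (outside v∈S) (shortcut u∈S v∈S b)
    where b = interval⇒between _⊠_ z∈I

  part-ii : ¬ InInterval (Adj H) h₁ h₂ h₃ → ¬ InInterval _⊠_ (g₁ , h₁) (g₁ , h₂) (g₂ , h₃)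
  part-ii h₃∉I z∈I = h₃∉I (between-projects-H b λ k w → minimal b k (along-H w))
    where b = interval⇒between _⊠_ z∈I

  part-iii : ¬ InInterval (Adj H) h₁ h₂ h₃ → ¬ InInterval _⊠_ (g₁ , h₁) (g₂ , h₂) (g₁ , h₃)
  part-iii h₃∉I z∈I = h₃∉I (between-projects-H b λ k w →
      minimal-⊔ b (≢-sym (h₁≢h₃ ∘ cong proj₂)) (combine (project-G (fromZ b)) (k , ≤-refl , w)))
    where b = interval⇒between _⊠_ z∈I
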